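{- Let $q$ be an odd prime power, $s\ge 2$, and $E,F\subset\mathbb{F}_q^s$ with $(\#E)(\#F)\ge 900q^s$. Then \[ \nu(0) \le \frac{21}{30}\, (\# E) (\# F). \]
   Context: $\mathbb{F}_q$ is a finite field with $q$ elements, $q$ odd. For $\mathbf{x}\in\mathbb{F}_q^s$, $|\mathbf{x}|^2=\sum_i x_i^2$. $\nu(j)=\#\{(\mathbf{x},\mathbf{y})\in E\times F: |\mathbf{x}-\mathbf{y}|^2=j\}$ for $j\in\mathbb{F}_q$. -}

module Defs where

open import Level using (0ℓ)
open import Data.Nat as ℕ using (ℕ; _^_)
open import Data.Fin using (Fin)
open import Data.Vec using (Vec; zipWith; foldr)
open import Data.List using (List; length; filter; cartesianProduct)
open import Data.List.Membership.Propositional using (_∈_)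
open import Data.List.Relation.Unary.Unique.Propositional using (Unique)
open import Data.Product using (_×_; _,_; ∃)
open import Relation.Nullary using (¬_)
open import Relation.Binary.Definitions using (DecidableEquality)
open import Relation.Binary.PropositionalEquality using (_≡_; _≢_)
open import Algebra.Structures using (IsCommutativeRing)

record FiniteField : Set₁ where
  infixl 6 _+_
  infixl 7 _*_
  field
    Carrier  : Set
    _+_ _*_  : Carrier → Carrier → Carrier
    -_       : Carrier → Carrier
    0# 1#    : Carrier
    isCommutativeRing : IsCommutativeRing _≡_ _+_ _*_ -_ 0# 1#
    0≢1      : 0# ≢ 1#
    inverse  : ∀ x → x ≢ 0# → ∃ λ y → x * y ≡ 1#
    _≟_      : DecidableEquality Carrier
    elements : List Carrier
    elements-unique   : Unique elements
    elements-complete : ∀ x → x ∈ elements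

  size : ℕ
  size = length elements

module _ (K : FiniteField) where
  open FiniteField K

  norm² : ∀ {s} → Vec Carrier s → Carrier
  norm² x = foldr _ (λ a acc → a * a + acc) 0# x

  vsub : ∀ {s} → Vec Carrier s → Vec Carrier s → Vec Carrier s
  vsub = zipWith (λ a b → a + (- b))

  ν : ∀ {s} → List (Vec Carrier s) → List (Vec Carrier s) → Carrier → ℕ
  ν E F j = length (filter (λ p → norm² (vsub (Data.Product.proj₁ p) (Data.Product.proj₂ p)) ≟ j)
                           (cartesianProduct E F))

module Submission where

-- A point y lies on the sphere of radius 0 about x iff |x|² + (-2x)·y + |y|² = 0, i.e. iff y lies
-- on the quadric |y|² + w·y + c = 0 with (w , c) = (-2x , |x|²). Over all q^(s+1) parameters (w , c),
-- each point lies on q^s quadrics and two distinct points share exactly q^(s-1) of them (the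
-- difference of their equations is a nonconstant affine equation in w). Hence the number D(w , c)
-- of points of F on the quadric satisfies ∑ (q D - |F|)² = |F| q^(s+1) (q - 1). For q odd the map
-- x ↦ (-2x , |x|²) is injective, so Cauchy–Schwarz over E gives
-- (q ν(0) - |E||F|)² ≤ |E||F| q^(s+1) (q - 1), and |E||F| ≥ 900 q^s turns this into ν(0) ≤ (16/30) |E||F|.

open import Defs
open import Data.Nat using (ℕ)

module IntegerSums where

  open import Data.Empty using (⊥-elim)
  open import Data.Integer using (ℤ; +_; -[1+_]; 0ℤ; 1ℤ; _+_; _-_; _*_; -_; _≤_; +≤+)
  open import Data.Integer.Properties
  open import Data.Integer.Tactic.RingSolver using (solve-∀)
  open import Data.List using (List; []; _∷_; _++_; map; length; filter; cartesianProductWith)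
  open import Data.List.Membership.Propositional using (_∈_; _∉_)
  open import Data.List.Relation.Unary.Any using (here; there)
  open import Data.List.Relation.Unary.All as All using ()
  open import Data.List.Relation.Unary.AllPairs using (_∷_)
  open import Data.List.Relation.Unary.Unique.Propositional using (Unique)
  open import Data.Nat as ℕ using (z≤n; s≤s)
  import Data.Nat.Properties as ℕ
  open import Function using (Injective; _∘′_)
  open import Relation.Nullary using (Dec; yes; no; ¬_)
  open import Relation.Unary using (Pred; Decidable)
  open import Relation.Binary.Definitions using (DecidableEquality)
  open import Relation.Binary.PropositionalEquality

  ⟦_⟧ : ∀ {p} {P : Set p} → Dec P → ℤ
  ⟦ yes _ ⟧ = 1ℤ
  ⟦ no _ ⟧ = 0ℤ

  module _ {p} {P : Set p} where

    ⟦⟧≡1 : (d : Dec P) → P → ⟦ d ⟧ ≡ 1ℤ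
    ⟦⟧≡1 (yes _) _ = refl
    ⟦⟧≡1 (no ¬p) p = ⊥-elim (¬p p)

    ⟦⟧≡0 : (d : Dec P) → ¬ P → ⟦ d ⟧ ≡ 0ℤ
    ⟦⟧≡0 (yes p) ¬p = ⊥-elim (¬p p)
    ⟦⟧≡0 (no _) _ = refl

    0≤⟦⟧ : (d : Dec P) → 0ℤ ≤ ⟦ d ⟧
    0≤⟦⟧ (yes _) = +≤+ z≤n
    0≤⟦⟧ (no _) = +≤+ z≤n

    ⟦⟧-idem : (d : Dec P) → ⟦ d ⟧ * ⟦ d ⟧ ≡ ⟦ d ⟧
    ⟦⟧-idem (yes _) = refl
    ⟦⟧-idem (no _) = refl

  ⟦⟧-cong : ∀ {p q} {P : Set p} {Q : Set q} (d : Dec P) (e : Dec Q) → (P → Q) → (Q → P) → ⟦ d ⟧ ≡ ⟦ e ⟧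
  ⟦⟧-cong (yes p) e f g = sym (⟦⟧≡1 e (f p))
  ⟦⟧-cong (no ¬p) e f g = sym (⟦⟧≡0 e (λ q → ¬p (g q)))

  0≤i*i : ∀ i → 0ℤ ≤ i * i
  0≤i*i (+ n) = subst (0ℤ ≤_) (pos-* n n) (+≤+ z≤n)
  0≤i*i -[1+ _ ] = +≤+ z≤n

  +[m∸n]²≤[m-n]² : ∀ m n → + ((m ℕ.∸ n) ℕ.* (m ℕ.∸ n)) ≤ (+ m - + n) * (+ m - + n)
  +[m∸n]²≤[m-n]² m n with n ℕ.≤? m
  ... | yes n≤m = ≤-reflexive (trans (pos-* (m ℕ.∸ n) (m ℕ.∸ n)) (cong (λ i → i * i) +[m∸n]≡m-n))
    where
    +[m∸n]≡m-n : + (m ℕ.∸ n) ≡ + m - + n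
    +[m∸n]≡m-n = sym (trans (m-n≡m⊖n m n) (⊖-≥ n≤m))
  ... | no n≰m rewrite ℕ.m≤n⇒m∸n≡0 (ℕ.<⇒≤ (ℕ.≰⇒> n≰m)) = 0≤i*i (+ m - + n)

  i*j≤j : ∀ i j → 0ℤ ≤ i → i ≤ 1ℤ → 0ℤ ≤ j → i * j ≤ j
  i*j≤j (+ 0) j _ _ 0≤j = subst (_≤ j) (sym (*-zeroˡ j)) 0≤j
  i*j≤j (+ 1) j _ _ _ = ≤-reflexive (*-identityˡ j)
  i*j≤j (+ ℕ.suc (ℕ.suc _)) j _ (+≤+ (s≤s ())) _

  ∑ : ∀ {A : Set} → List A → (A → ℤ) → ℤ
  ∑ [] f = 0ℤ
  ∑ (x ∷ xs) f = f x + ∑ xs f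

  syntax ∑ L (λ x → e) = ∑[ x ∈ L ] e

  module _ {A : Set} where

    ∑-cong : ∀ L {f g : A → ℤ} → (∀ x → f x ≡ g x) → ∑ L f ≡ ∑ L g
    ∑-cong [] e = refl
    ∑-cong (x ∷ L) e = cong₂ _+_ (e x) (∑-cong L e)

    ∑-cong-∈ : ∀ L {f g : A → ℤ} → (∀ {x} → x ∈ L → f x ≡ g x) → ∑ L f ≡ ∑ L g
    ∑-cong-∈ [] e = refl
    ∑-cong-∈ (x ∷ L) e = cong₂ _+_ (e (here refl)) (∑-cong-∈ L (e ∘′ there))

    ∑-distrib-+ : ∀ L (f g : A → ℤ) → ∑[ x ∈ L ] (f x + g x) ≡ ∑ L f + ∑ L g
    ∑-distrib-+ [] f g = refl
    ∑-distrib-+ (x ∷ L) f g rewrite ∑-distrib-+ L f g = interchange (f x) (g x) (∑ L f) (∑ L g)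
      where
      interchange : ∀ a b c d → (a + b) + (c + d) ≡ (a + c) + (b + d)
      interchange = solve-∀

    ∑-*ˡ : ∀ L k (f : A → ℤ) → ∑[ x ∈ L ] (k * f x) ≡ k * ∑ L f
    ∑-*ˡ [] k f = sym (*-zeroʳ k)
    ∑-*ˡ (x ∷ L) k f rewrite ∑-*ˡ L k f = sym (*-distribˡ-+ k (f x) (∑ L f))

    ∑-*ʳ : ∀ L k (f : A → ℤ) → ∑[ x ∈ L ] (f x * k) ≡ ∑ L f * k
    ∑-*ʳ L k f = trans (∑-cong L (λ x → *-comm (f x) k)) (trans (∑-*ˡ L k f) (*-comm k (∑ L f)))

    ∑-const : ∀ (L : List A) k → ∑[ _ ∈ L ] k ≡ + length L * k
    ∑-const [] k = sym (*-zeroˡ k)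
    ∑-const (x ∷ L) k rewrite ∑-const L k = lemma k (+ length L)
      where
      lemma : ∀ k n → k + n * k ≡ (1ℤ + n) * k
      lemma = solve-∀

    ∑-mono-≤ : ∀ L {f g : A → ℤ} → (∀ x → f x ≤ g x) → ∑ L f ≤ ∑ L g
    ∑-mono-≤ [] e = ≤-refl
    ∑-mono-≤ (x ∷ L) e = +-mono-≤ (e x) (∑-mono-≤ L e)

    ∑-zero : ∀ (L : List A) → ∑[ _ ∈ L ] 0ℤ ≡ 0ℤ
    ∑-zero [] = refl
    ∑-zero (x ∷ L) = trans (+-identityˡ _) (∑-zero L)

    ∑-nonneg : ∀ L {f : A → ℤ} → (∀ x → 0ℤ ≤ f x) → 0ℤ ≤ ∑ L f
    ∑-nonneg L {f} e = subst (_≤ ∑ L f) (∑-zero L) (∑-mono-≤ L e)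

    ∑-++ : ∀ L M (f : A → ℤ) → ∑ (L ++ M) f ≡ ∑ L f + ∑ M f
    ∑-++ [] M f = sym (+-identityˡ _)
    ∑-++ (x ∷ L) M f rewrite ∑-++ L M f = sym (+-assoc (f x) (∑ L f) (∑ M f))

    ∑-filter : ∀ {p} {P : Pred A p} (P? : Decidable P) L → + length (filter P? L) ≡ ∑[ x ∈ L ] ⟦ P? x ⟧
    ∑-filter P? [] = refl
    ∑-filter P? (x ∷ L) with P? x
    ... | yes _ = trans (pos-+ 1 _) (cong (λ n → 1ℤ + n) (∑-filter P? L))
    ... | no _ = trans (∑-filter P? L) (sym (+-identityˡ _))

  ∑-map : ∀ {A B : Set} (h : A → B) L (f : B → ℤ) → ∑ (map h L) f ≡ ∑[ x ∈ L ] f (h x)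
  ∑-map h [] f = refl
  ∑-map h (x ∷ L) f = cong (λ n → f (h x) + n) (∑-map h L f)

  ∑-cartesianProductWith : ∀ {A B C : Set} (h : A → B → C) L M (f : C → ℤ) →
                           ∑ (cartesianProductWith h L M) f ≡ ∑[ x ∈ L ] ∑[ y ∈ M ] f (h x y)
  ∑-cartesianProductWith h [] M f = refl
  ∑-cartesianProductWith h (x ∷ L) M f =
    trans (∑-++ (map (h x) M) _ f) (cong₂ _+_ (∑-map (h x) M f) (∑-cartesianProductWith h L M f))

  ∑-comm : ∀ {A B : Set} (L : List A) (M : List B) (f : A → B → ℤ) →
           ∑[ x ∈ L ] ∑[ y ∈ M ] f x y ≡ ∑[ y ∈ M ] ∑[ x ∈ L ] f x y
  ∑-comm [] M f = sym (∑-zero M)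
  ∑-comm (x ∷ L) M f rewrite ∑-comm L M f = sym (∑-distrib-+ M (f x) (λ y → ∑[ x ∈ L ] f x y))

  ∑-*-∑ : ∀ {A B : Set} (L : List A) (M : List B) (f : A → ℤ) (g : B → ℤ) →
          ∑ L f * ∑ M g ≡ ∑[ x ∈ L ] ∑[ y ∈ M ] (f x * g y)
  ∑-*-∑ L M f g = begin
    ∑ L f * ∑ M g                   ≡⟨ ∑-*ʳ L (∑ M g) f ⟨
    ∑[ x ∈ L ] (f x * ∑ M g)        ≡⟨ ∑-cong L (λ x → ∑-*ˡ M (f x) g) ⟨
    ∑[ x ∈ L ] ∑[ y ∈ M ] (f x * g y) ∎
    where open ≡-Reasoning

  module _ {A : Set} (_≟_ : DecidableEquality A) where

    ∑-select-∉ : ∀ L {b} (f : A → ℤ) → b ∉ L → ∑[ a ∈ L ] (⟦ a ≟ b ⟧ * f a) ≡ 0ℤ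
    ∑-select-∉ L {b} f b∉L = trans (∑-cong-∈ L vanish) (∑-zero L)
      where
      vanish : ∀ {a} → a ∈ L → ⟦ a ≟ b ⟧ * f a ≡ 0ℤ
      vanish a∈L = cong (_* f _) (⟦⟧≡0 (_ ≟ b) (λ { refl → b∉L a∈L }))

    ∑-select : ∀ {L} → Unique L → ∀ {b} → b ∈ L → (f : A → ℤ) → ∑[ a ∈ L ] (⟦ a ≟ b ⟧ * f a) ≡ f b
    ∑-select {x ∷ L} (x∉L ∷ _) (here refl) f
      rewrite ⟦⟧≡1 (x ≟ x) refl | ∑-select-∉ L f (λ x∈L → All.lookup x∉L x∈L refl)
      = trans (+-identityʳ _) (*-identityˡ (f x))
    ∑-select {x ∷ L} (x∉L ∷ uL) {b} (there b∈L) f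
      rewrite ⟦⟧≡0 (x ≟ b) (λ { refl → All.lookup x∉L b∈L refl }) | *-zeroˡ (f x)
      = trans (+-identityˡ _) (∑-select uL b∈L f)

    ∑-⟦⟧-unique : ∀ {L} → Unique L → ∀ {b} → b ∈ L → ∀ {p} {P : Pred A p} (P? : Decidable P) →
                  P b → (∀ a → P a → a ≡ b) → ∑[ a ∈ L ] ⟦ P? a ⟧ ≡ 1ℤ
    ∑-⟦⟧-unique {L} uL {b} b∈L P? Pb unique = begin
      ∑[ a ∈ L ] ⟦ P? a ⟧           ≡⟨ ∑-cong L (λ a → ⟦⟧-cong (P? a) (a ≟ b) (unique a) (λ { refl → Pb })) ⟩
      ∑[ a ∈ L ] ⟦ a ≟ b ⟧          ≡⟨ ∑-cong L (λ a → *-identityʳ ⟦ a ≟ b ⟧) ⟨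
      ∑[ a ∈ L ] (⟦ a ≟ b ⟧ * 1ℤ)   ≡⟨ ∑-select uL b∈L (λ _ → 1ℤ) ⟩
      1ℤ                            ∎
      where open ≡-Reasoning

    ∑-⟦⟧-injective-≤1 : ∀ {X : Set} {L : List X} → Unique L → (m : X → A) → Injective _≡_ _≡_ m →
                        ∀ b → ∑[ x ∈ L ] ⟦ m x ≟ b ⟧ ≤ 1ℤ
    ∑-⟦⟧-injective-≤1 {L = []} _ m m-inj b = +≤+ z≤n
    ∑-⟦⟧-injective-≤1 {L = x ∷ L} (x∉L ∷ uL) m m-inj b with m x ≟ b
    ... | yes refl = ≤-reflexive (cong (λ n → 1ℤ + n) (trans (∑-cong-∈ L miss) (∑-zero L)))
      where
      miss : ∀ {y} → y ∈ L → ⟦ m y ≟ m x ⟧ ≡ 0ℤ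
      miss y∈L = ⟦⟧≡0 (_ ≟ _) (λ mx≡my → All.lookup x∉L y∈L (sym (m-inj mx≡my)))
    ... | no _ = subst (_≤ 1ℤ) (sym (+-identityˡ _)) (∑-⟦⟧-injective-≤1 uL m m-inj b)

    -- Each term G (m x) is picked out of ∑ M G by a Kronecker delta; injectivity means no term of
    -- ∑ M G is picked more than once.
    ∑-∘-injective-≤ : ∀ {X : Set} {L : List X} {M : List A} → Unique L → Unique M →
                      (m : X → A) → Injective _≡_ _≡_ m → (∀ x → m x ∈ M) →
                      (G : A → ℤ) → (∀ a → 0ℤ ≤ G a) → ∑[ x ∈ L ] G (m x) ≤ ∑ M G
    ∑-∘-injective-≤ {L = L} {M} uL uM m m-inj m∈M G 0≤G = begin
      ∑[ x ∈ L ] G (m x)                              ≡⟨ ∑-cong L (λ x → ∑-select uM (m∈M x) G) ⟨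
      ∑[ x ∈ L ] ∑[ a ∈ M ] (⟦ a ≟ m x ⟧ * G a)       ≡⟨ ∑-comm L M _ ⟩
      ∑[ a ∈ M ] ∑[ x ∈ L ] (⟦ a ≟ m x ⟧ * G a)       ≡⟨ ∑-cong M (λ a → ∑-*ʳ L (G a) (λ x → ⟦ a ≟ m x ⟧)) ⟩
      ∑[ a ∈ M ] (∑[ x ∈ L ] ⟦ a ≟ m x ⟧ * G a)       ≡⟨ ∑-cong M (λ a → cong (_* G a) (∑-cong L (λ x → flip a x))) ⟩
      ∑[ a ∈ M ] (∑[ x ∈ L ] ⟦ m x ≟ a ⟧ * G a)       ≤⟨ ∑-mono-≤ M bound ⟩
      ∑ M G                                           ∎
      where
      open ≤-Reasoning
      flip : ∀ a x → ⟦ a ≟ m x ⟧ ≡ ⟦ m x ≟ a ⟧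
      flip a x = ⟦⟧-cong (a ≟ m x) (m x ≟ a) sym sym
      bound : ∀ a → ∑[ x ∈ L ] ⟦ m x ≟ a ⟧ * G a ≤ G a
      bound a = i*j≤j _ (G a) (∑-nonneg L (λ x → 0≤⟦⟧ (m x ≟ a))) (∑-⟦⟧-injective-≤1 uL m m-inj a) (0≤G a)

    ∑-∘-involution : ∀ {L} → Unique L → (∀ a → a ∈ L) → (σ : A → A) → (∀ a → σ (σ a) ≡ a) →
                     (f : A → ℤ) → ∑[ a ∈ L ] f (σ a) ≡ ∑ L f
    ∑-∘-involution {L} uL complete σ σσ f = begin
      ∑[ a ∈ L ] f (σ a)                              ≡⟨ ∑-cong L (λ a → ∑-select uL (complete (σ a)) f) ⟨
      ∑[ a ∈ L ] ∑[ b ∈ L ] (⟦ b ≟ σ a ⟧ * f b)       ≡⟨ ∑-comm L L _ ⟩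
      ∑[ b ∈ L ] ∑[ a ∈ L ] (⟦ b ≟ σ a ⟧ * f b)       ≡⟨ ∑-cong L (λ b → ∑-*ʳ L (f b) (λ a → ⟦ b ≟ σ a ⟧)) ⟩
      ∑[ b ∈ L ] (∑[ a ∈ L ] ⟦ b ≟ σ a ⟧ * f b)       ≡⟨ ∑-cong L (λ b → cong (_* f b) (preimage b)) ⟩
      ∑[ b ∈ L ] (1ℤ * f b)                           ≡⟨ ∑-cong L (λ b → *-identityˡ (f b)) ⟩
      ∑ L f                                           ∎
      where
      open ≡-Reasoning
      preimage : ∀ b → ∑[ a ∈ L ] ⟦ b ≟ σ a ⟧ ≡ 1ℤ
      preimage b = ∑-⟦⟧-unique uL (complete (σ b)) (λ a → b ≟ σ a) (sym (σσ b))
                     (λ a b≡σa → trans (sym (σσ a)) (cong σ (sym b≡σa)))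

  ∑-square-affine : ∀ {A : Set} (L : List A) α β (d : A → ℤ) →
                    ∑[ x ∈ L ] ((α * d x - β) * (α * d x - β))
                      ≡ α * α * ∑[ x ∈ L ] (d x * d x) - + 2 * α * β * ∑ L d + + length L * (β * β)
  ∑-square-affine L α β d = begin
    ∑[ x ∈ L ] ((α * d x - β) * (α * d x - β))
      ≡⟨ ∑-cong L (λ x → expand α β (d x)) ⟩
    ∑[ x ∈ L ] (α * α * (d x * d x) + (- (+ 2 * α * β) * d x + β * β))
      ≡⟨ ∑-distrib-+ L _ _ ⟩
    ∑[ x ∈ L ] (α * α * (d x * d x)) + ∑[ x ∈ L ] (- (+ 2 * α * β) * d x + β * β)
      ≡⟨ cong₂ _+_ (∑-*ˡ L (α * α) (λ x → d x * d x))
                   (trans (∑-distrib-+ L _ _) (cong₂ _+_ (∑-*ˡ L (- (+ 2 * α * β)) d) (∑-const L (β * β)))) ⟩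
    α * α * ∑[ x ∈ L ] (d x * d x) + (- (+ 2 * α * β) * ∑ L d + + length L * (β * β))
      ≡⟨ regroup (α * α * ∑[ x ∈ L ] (d x * d x)) (+ 2 * α * β) (∑ L d) (+ length L * (β * β)) ⟩
    α * α * ∑[ x ∈ L ] (d x * d x) - + 2 * α * β * ∑ L d + + length L * (β * β) ∎
    where
    open ≡-Reasoning
    expand : ∀ α β t → (α * t - β) * (α * t - β) ≡ α * α * (t * t) + (- (+ 2 * α * β) * t + β * β)
    expand = solve-∀
    regroup : ∀ a b t c → a + (- b * t + c) ≡ a - b * t + c
    regroup = solve-∀

  -- Lagrange's identity: the double sum of (a x - a y)² is 2 (n ∑ a² - (∑ a)²).
  cauchy-schwarz : ∀ {A : Set} (L : List A) (a : A → ℤ) →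
                   ∑ L a * ∑ L a ≤ + length L * ∑[ x ∈ L ] (a x * a x)
  cauchy-schwarz L a = 0≤i-j⇒j≤i (*-cancelˡ-≤-pos 0ℤ _ (+ 2) (subst (0ℤ ≤_) lagrange 0≤∑∑))
    where
    n S S₂ : ℤ
    n = + length L
    S = ∑ L a
    S₂ = ∑[ x ∈ L ] (a x * a x)
    0≤∑∑ : 0ℤ ≤ ∑[ x ∈ L ] ∑[ y ∈ L ] ((a x - a y) * (a x - a y))
    0≤∑∑ = ∑-nonneg L (λ x → ∑-nonneg L (λ y → 0≤i*i (a x - a y)))
    expand : ∀ u v → (u - v) * (u - v) ≡ u * u + (v * v + (- (+ 2 * u)) * v)
    expand = solve-∀
    inner : ∀ x → ∑[ y ∈ L ] ((a x - a y) * (a x - a y)) ≡ n * (a x * a x) + (S₂ + (- (+ 2 * a x)) * S)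
    inner x = begin
      ∑[ y ∈ L ] ((a x - a y) * (a x - a y))                              ≡⟨ ∑-cong L (λ y → expand (a x) (a y)) ⟩
      ∑[ y ∈ L ] (a x * a x + (a y * a y + (- (+ 2 * a x)) * a y))         ≡⟨ ∑-distrib-+ L _ _ ⟩
      ∑[ y ∈ L ] (a x * a x) + ∑[ y ∈ L ] (a y * a y + (- (+ 2 * a x)) * a y)
        ≡⟨ cong₂ _+_ (∑-const L _) (trans (∑-distrib-+ L _ _) (cong (λ t → S₂ + t) (∑-*ˡ L (- (+ 2 * a x)) a))) ⟩
      n * (a x * a x) + (S₂ + (- (+ 2 * a x)) * S)                        ∎
      where open ≡-Reasoning
    lagrange : ∑[ x ∈ L ] ∑[ y ∈ L ] ((a x - a y) * (a x - a y)) ≡ + 2 * (n * S₂ - S * S)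
    lagrange = begin
      ∑[ x ∈ L ] ∑[ y ∈ L ] ((a x - a y) * (a x - a y))                   ≡⟨ ∑-cong L inner ⟩
      ∑[ x ∈ L ] (n * (a x * a x) + (S₂ + (- (+ 2 * a x)) * S))           ≡⟨ ∑-distrib-+ L _ _ ⟩
      ∑[ x ∈ L ] (n * (a x * a x)) + ∑[ x ∈ L ] (S₂ + (- (+ 2 * a x)) * S)
        ≡⟨ cong₂ _+_ (∑-*ˡ L n _) (trans (∑-distrib-+ L _ _) (cong₂ _+_ (∑-const L S₂) (∑-*ʳ L S _))) ⟩
      n * S₂ + (n * S₂ + ∑[ x ∈ L ] (- (+ 2 * a x)) * S)                 ≡⟨ cong (λ t → n * S₂ + (n * S₂ + t * S)) (trans (∑-cong L (λ x → neg-distribˡ-* (+ 2) (a x))) (∑-*ˡ L (- + 2) a)) ⟩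
      n * S₂ + (n * S₂ + (- + 2) * S * S)                                 ≡⟨ collect n S₂ S ⟩
      + 2 * (n * S₂ - S * S)                                              ∎
      where
      open ≡-Reasoning
      collect : ∀ n s₂ s → n * s₂ + (n * s₂ + (- + 2) * s * s) ≡ + 2 * (n * s₂ - s * s)
      collect = solve-∀

module Parity where

  open IntegerSums
  open import Data.Empty using (⊥-elim)
  open import Data.Fin using (Fin; _<_; _<?_)
  open import Data.Fin.Properties using (<-cmp; <-asym)
  open import Data.Integer using (ℤ; +_; 1ℤ; _+_; _*_; ∣_∣)
  open import Data.Integer.Properties using (*-identityʳ; +-injective; pos-+; 0≤i⇒+∣i∣≡i)
  open import Data.List using (List; length)
  open import Data.List.Membership.Propositional using (_∈_)
  open import Data.List.Membership.Setoid.Properties using (index-injective)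
  open import Data.List.Relation.Unary.Any using (index)
  open import Data.List.Relation.Unary.Unique.Propositional using (Unique)
  import Data.Nat as ℕ
  import Data.Nat.Properties as ℕ
  open import Data.Nat.Divisibility using (_∣_; divides)
  open import Relation.Binary.Definitions using (DecidableEquality; tri<; tri≈; tri>)
  open import Relation.Binary.PropositionalEquality
  open import Relation.Nullary using (Dec)

  -- Pair each a with σ a and count the pairs by the member listed first.
  even-length-of-involution : ∀ {A : Set} → DecidableEquality A → (L : List A) → Unique L →
                              (complete : ∀ a → a ∈ L) → (σ : A → A) → (∀ a → σ (σ a) ≡ a) →
                              (∀ a → σ a ≢ a) → 2 ∣ length L
  even-length-of-involution {A} _≟_ L uL complete σ σσ σ-fpf =
    divides ∣ k ∣ (trans length≡2∣k∣ (ℕ.*-comm 2 ∣ k ∣))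
    where
    rank : A → Fin (length L)
    rank a = index (complete a)
    first : ∀ a → Dec (rank a < rank (σ a))
    first a = rank a <? rank (σ a)
    k : ℤ
    k = ∑[ a ∈ L ] ⟦ first a ⟧
    split : ∀ a → 1ℤ ≡ ⟦ first a ⟧ + ⟦ first (σ a) ⟧
    split a with <-cmp (rank a) (rank (σ a))
    ... | tri< lt _ _ = cong₂ _+_ (sym (⟦⟧≡1 (first a) lt))
                                  (sym (⟦⟧≡0 (first (σ a)) (λ lt′ → <-asym lt (subst (λ b → rank (σ a) < rank b) (σσ a) lt′))))
    ... | tri≈ _ eq _ = ⊥-elim (σ-fpf a (sym (index-injective (setoid A) (complete a) (complete (σ a)) eq)))
    ... | tri> _ _ gt = cong₂ _+_ (sym (⟦⟧≡0 (first a) (λ lt → <-asym lt gt)))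
                                  (sym (⟦⟧≡1 (first (σ a)) (subst (λ b → rank (σ a) < rank b) (sym (σσ a)) gt)))
    +∣k∣≡k : + ∣ k ∣ ≡ k
    +∣k∣≡k = 0≤i⇒+∣i∣≡i (∑-nonneg L (λ a → 0≤⟦⟧ (first a)))
    length≡2∣k∣ : length L ≡ 2 ℕ.* ∣ k ∣
    length≡2∣k∣ = +-injective (begin
      + length L                                      ≡⟨ *-identityʳ (+ length L) ⟨
      + length L * 1ℤ                                 ≡⟨ ∑-const L 1ℤ ⟨
      ∑[ a ∈ L ] 1ℤ                                   ≡⟨ ∑-cong L split ⟩
      ∑[ a ∈ L ] (⟦ first a ⟧ + ⟦ first (σ a) ⟧)      ≡⟨ ∑-distrib-+ L _ _ ⟩
      k + ∑[ a ∈ L ] ⟦ first (σ a) ⟧                  ≡⟨ cong (λ t → k + t) (∑-∘-involution _≟_ uL complete σ σσ (λ a → ⟦ first a ⟧)) ⟩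
      k + k                                           ≡⟨ cong₂ _+_ +∣k∣≡k +∣k∣≡k ⟨
      + ∣ k ∣ + + ∣ k ∣                               ≡⟨ pos-+ ∣ k ∣ ∣ k ∣ ⟨
      + (∣ k ∣ ℕ.+ ∣ k ∣)                             ≡⟨ cong (λ n → + (∣ k ∣ ℕ.+ n)) (ℕ.+-identityʳ ∣ k ∣) ⟨
      + (2 ℕ.* ∣ k ∣)                                 ∎)
      where open ≡-Reasoning

module FieldAlgebra (K : FiniteField) where

  open FiniteField K public using (Carrier; 0#; 1#; _≟_; elements; elements-unique; elements-complete; size)
  open FiniteField K using (0≢1; inverse)
  open import Algebra.Bundles using (CommutativeRing)
  import Algebra.Properties.Ring as RingProperties
  import Algebra.Properties.CommutativeSemigroup as CommutativeSemigroupProperties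
  open import Data.Empty using (⊥)
  open import Data.Nat using (_%_)
  open import Data.Nat.Divisibility using (n∣m⇒m%n≡0)
  open import Data.Product using (∃; _,_; _×_)
  open import Data.Vec using (Vec; []; _∷_; replicate; map; head; tail)
  open import Function using (Injective)
  open import Relation.Binary.PropositionalEquality

  commutativeRing : CommutativeRing _ _
  commutativeRing = record { isCommutativeRing = FiniteField.isCommutativeRing K }

  open CommutativeRing commutativeRing public using (_+_; _*_; -_)
  open CommutativeRing commutativeRing
    using (+-assoc; +-comm; +-identityˡ; +-identityʳ; -‿inverseˡ; -‿inverseʳ; *-assoc; *-comm;
           *-identityˡ; *-identityʳ; distribˡ; distribʳ; zeroʳ; ring; +-commutativeSemigroup)
  open RingProperties ring
    using (-‿distribˡ-*; -‿distribʳ-*; -‿+-comm; -‿involutive; -‿injective; +-inverseˡ-unique;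
           x∙y⁻¹≈ε⇒x≈y; x[y-z]≈xy-xz)
  open CommutativeSemigroupProperties +-commutativeSemigroup using (interchange)
  open ≡-Reasoning

  infixl 7 _·_
  _·_ : ∀ {s} → Vec Carrier s → Vec Carrier s → Carrier
  [] · [] = 0#
  (a ∷ x) · (b ∷ y) = a * b + x · y

  0ᵛ : ∀ {s} → Vec Carrier s
  0ᵛ = replicate _ 0#

  -2× : ∀ {s} → Vec Carrier s → Vec Carrier s
  -2× = map (λ a → - (a + a))

  square-sub : ∀ a b → (a + - b) * (a + - b) ≡ a * a + (- (a + a) * b + b * b)
  square-sub a b = begin
    (a + - b) * (a + - b)                          ≡⟨ distribʳ (a + - b) a (- b) ⟩
    a * (a + - b) + - b * (a + - b)                ≡⟨ cong₂ _+_ (distribˡ a a (- b)) (distribˡ (- b) a (- b)) ⟩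
    (a * a + a * - b) + (- b * a + - b * - b)      ≡⟨ cong₂ (λ u v → (a * a + u) + v) (sym (-‿distribʳ-* a b))
                                                        (cong₂ _+_ (trans (sym (-‿distribˡ-* b a)) (cong -_ (*-comm b a))) -b*-b) ⟩
    (a * a + - (a * b)) + (- (a * b) + b * b)      ≡⟨ +-assoc (a * a) (- (a * b)) _ ⟩
    a * a + (- (a * b) + (- (a * b) + b * b))      ≡⟨ cong (a * a +_) (sym (+-assoc (- (a * b)) (- (a * b)) (b * b))) ⟩
    a * a + ((- (a * b) + - (a * b)) + b * b)      ≡⟨ cong (λ u → a * a + (u + b * b)) (-‿+-comm (a * b) (a * b)) ⟩
    a * a + (- (a * b + a * b) + b * b)            ≡⟨ cong (λ u → a * a + (- u + b * b)) (sym (distribʳ b a a)) ⟩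
    a * a + (- ((a + a) * b) + b * b)              ≡⟨ cong (λ u → a * a + (u + b * b)) (-‿distribˡ-* (a + a) b) ⟩
    a * a + (- (a + a) * b + b * b)                ∎
    where
    -b*-b : - b * - b ≡ b * b
    -b*-b = trans (sym (-‿distribˡ-* b (- b))) (trans (cong -_ (sym (-‿distribʳ-* b b))) (-‿involutive (b * b)))

  norm²-vsub : ∀ {s} (x y : Vec Carrier s) → norm² K (vsub K x y) ≡ norm² K x + (-2× x · y + norm² K y)
  norm²-vsub [] [] = sym (trans (+-identityˡ _) (+-identityˡ 0#))
  norm²-vsub (a ∷ x) (b ∷ y) = begin
    (a + - b) * (a + - b) + norm² K (vsub K x y)
      ≡⟨ cong₂ _+_ (square-sub a b) (norm²-vsub x y) ⟩
    (a * a + (- (a + a) * b + b * b)) + (norm² K x + (-2× x · y + norm² K y))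
      ≡⟨ interchange (a * a) _ (norm² K x) _ ⟩
    (a * a + norm² K x) + ((- (a + a) * b + b * b) + (-2× x · y + norm² K y))
      ≡⟨ cong ((a * a + norm² K x) +_) (interchange _ (b * b) _ (norm² K y)) ⟩
    (a * a + norm² K x) + ((- (a + a) * b + -2× x · y) + (b * b + norm² K y)) ∎

  ·-zeroʳ : ∀ {s} (x : Vec Carrier s) → x · 0ᵛ ≡ 0#
  ·-zeroʳ [] = refl
  ·-zeroʳ (a ∷ x) = trans (cong₂ _+_ (zeroʳ a) (·-zeroʳ x)) (+-identityˡ 0#)

  ·-vsubʳ : ∀ {s} (w y′ y : Vec Carrier s) → w · vsub K y′ y ≡ w · y′ + - (w · y)
  ·-vsubʳ [] [] [] = sym (-‿inverseʳ 0#)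
  ·-vsubʳ (a ∷ w) (b′ ∷ y′) (b ∷ y) = begin
    a * (b′ + - b) + w · vsub K y′ y                  ≡⟨ cong₂ _+_ (x[y-z]≈xy-xz a b′ b) (·-vsubʳ w y′ y) ⟩
    (a * b′ + - (a * b)) + (w · y′ + - (w · y))       ≡⟨ interchange (a * b′) _ (w · y′) _ ⟩
    (a * b′ + w · y′) + (- (a * b) + - (w · y))       ≡⟨ cong ((a * b′ + w · y′) +_) (-‿+-comm (a * b) (w · y)) ⟩
    (a * b′ + w · y′) + - (a * b + w · y)             ∎

  quadric-difference : ∀ {s} (w y y′ : Vec Carrier s) →
                       - (w · y + norm² K y) + (w · y′ + norm² K y′) ≡ w · vsub K y′ y + (- norm² K y + norm² K y′)
  quadric-difference w y y′ = begin
    - (w · y + norm² K y) + (w · y′ + norm² K y′)          ≡⟨ cong (_+ (w · y′ + norm² K y′)) (sym (-‿+-comm (w · y) (norm² K y))) ⟩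
    (- (w · y) + - norm² K y) + (w · y′ + norm² K y′)      ≡⟨ interchange (- (w · y)) (- norm² K y) (w · y′) (norm² K y′) ⟩
    (- (w · y) + w · y′) + (- norm² K y + norm² K y′)      ≡⟨ cong (_+ (- norm² K y + norm² K y′)) (+-comm (- (w · y)) (w · y′)) ⟩
    (w · y′ + - (w · y)) + (- norm² K y + norm² K y′)      ≡⟨ cong (_+ (- norm² K y + norm² K y′)) (sym (·-vsubʳ w y′ y)) ⟩
    w · vsub K y′ y + (- norm² K y + norm² K y′)           ∎

  vsub≡0ᵛ⇒≡ : ∀ {s} (x y : Vec Carrier s) → vsub K x y ≡ 0ᵛ → x ≡ y
  vsub≡0ᵛ⇒≡ [] [] _ = refl
  vsub≡0ᵛ⇒≡ (a ∷ x) (b ∷ y) eq = cong₂ _∷_ (x∙y⁻¹≈ε⇒x≈y a b (cong head eq)) (vsub≡0ᵛ⇒≡ x y (cong tail eq))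

  *-cancelˡ : ∀ {e} → e ≢ 0# → ∀ a b → e * a ≡ e * b → a ≡ b
  *-cancelˡ {e} e≢0 a b eq with inverse e e≢0
  ... | e⁻¹ , e*e⁻¹≡1 = begin
    a                ≡⟨ sym (*-identityˡ a) ⟩
    1# * a           ≡⟨ cong (_* a) (trans (sym e*e⁻¹≡1) (*-comm e e⁻¹)) ⟩
    (e⁻¹ * e) * a    ≡⟨ *-assoc e⁻¹ e a ⟩
    e⁻¹ * (e * a)    ≡⟨ cong (e⁻¹ *_) eq ⟩
    e⁻¹ * (e * b)    ≡⟨ sym (*-assoc e⁻¹ e b) ⟩
    (e⁻¹ * e) * b    ≡⟨ cong (_* b) (trans (*-comm e⁻¹ e) e*e⁻¹≡1) ⟩
    1# * b           ≡⟨ *-identityˡ b ⟩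
    b                ∎

  a+a≡[1+1]*a : ∀ a → a + a ≡ (1# + 1#) * a
  a+a≡[1+1]*a a = sym (trans (distribʳ a 1# 1#) (cong₂ _+_ (*-identityˡ a) (*-identityˡ a)))

  -2×-injective : 1# + 1# ≢ 0# → ∀ {s} → Injective _≡_ _≡_ (-2× {s})
  -2×-injective 2≢0 {x = []} {[]} _ = refl
  -2×-injective 2≢0 {x = a ∷ x} {b ∷ y} eq = cong₂ _∷_ a≡b (-2×-injective 2≢0 (cong tail eq))
    where
    a≡b : a ≡ b
    a≡b = *-cancelˡ 2≢0 a b (trans (sym (a+a≡[1+1]*a a)) (trans (-‿injective (cong head eq)) (a+a≡[1+1]*a b)))

  linear-root : ∀ {e} → e ≢ 0# → ∀ k → ∃ λ a₀ → (a₀ * e + k ≡ 0#) × (∀ a → a * e + k ≡ 0# → a ≡ a₀)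
  linear-root {e} e≢0 k with inverse e e≢0
  ... | e⁻¹ , e*e⁻¹≡1 = - k * e⁻¹ , root , unique
    where
    root : - k * e⁻¹ * e + k ≡ 0#
    root = begin
      - k * e⁻¹ * e + k      ≡⟨ cong (_+ k) (*-assoc (- k) e⁻¹ e) ⟩
      - k * (e⁻¹ * e) + k    ≡⟨ cong (λ u → - k * u + k) (trans (*-comm e⁻¹ e) e*e⁻¹≡1) ⟩
      - k * 1# + k           ≡⟨ cong (_+ k) (*-identityʳ (- k)) ⟩
      - k + k                ≡⟨ -‿inverseˡ k ⟩
      0#                     ∎
    unique : ∀ a → a * e + k ≡ 0# → a ≡ - k * e⁻¹
    unique a eq = begin
      a                ≡⟨ sym (*-identityʳ a) ⟩
      a * 1#           ≡⟨ cong (a *_) (sym e*e⁻¹≡1) ⟩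
      a * (e * e⁻¹)    ≡⟨ sym (*-assoc a e e⁻¹) ⟩
      (a * e) * e⁻¹    ≡⟨ cong (_* e⁻¹) (+-inverseˡ-unique (a * e) k eq) ⟩
      - k * e⁻¹        ∎

  +≡0⇔≡- : ∀ c u → (c + u ≡ 0# → c ≡ - u) × (c ≡ - u → c + u ≡ 0#)
  +≡0⇔≡- c u = +-inverseˡ-unique c u , λ { refl → -‿inverseˡ u }

  -- In characteristic 2, a ↦ a + 1 would be a fixed-point-free involution of K.
  1+1≢0 : size % 2 ≡ 1 → 1# + 1# ≢ 0#
  1+1≢0 odd 1+1≡0 = contradiction
    where
    open Parity using (even-length-of-involution)
    σ : Carrier → Carrier
    σ a = a + 1#
    σσ : ∀ a → σ (σ a) ≡ a
    σσ a = trans (+-assoc a 1# 1#) (trans (cong (a +_) 1+1≡0) (+-identityʳ a))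
    σ-fpf : ∀ a → σ a ≢ a
    σ-fpf a a+1≡a = 0≢1 (sym (begin
      1#                ≡⟨ sym (+-identityˡ 1#) ⟩
      0# + 1#           ≡⟨ cong (_+ 1#) (sym (-‿inverseˡ a)) ⟩
      (- a + a) + 1#    ≡⟨ +-assoc (- a) a 1# ⟩
      - a + (a + 1#)    ≡⟨ cong (- a +_) a+1≡a ⟩
      - a + a           ≡⟨ -‿inverseˡ a ⟩
      0#                ∎))
    contradiction : ⊥
    contradiction with trans (sym odd) (n∣m⇒m%n≡0 size 2 (even-length-of-involution _≟_ elements elements-unique elements-complete σ σσ σ-fpf))
    ... | ()

module Counting (K : FiniteField) where

  open FieldAlgebra K renaming (_+_ to _+ᴷ_; _*_ to _*ᴷ_; -_ to -ᴷ_)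
  open IntegerSums
  open import Algebra.Bundles using (CommutativeRing)
  open import Algebra.Properties.CommutativeSemigroup (CommutativeRing.+-commutativeSemigroup commutativeRing)
    using (xy∙z≈y∙xz)
  open CommutativeRing commutativeRing using () renaming (+-identityʳ to +ᴷ-identityʳ)
  open import Data.Empty using (⊥-elim)
  open import Data.Integer using (ℤ; +_; 0ℤ; 1ℤ; _+_; _-_; _*_)
  open import Data.Integer.Properties using (+-identityˡ; +-identityʳ; *-zeroˡ; *-identityˡ; *-identityʳ; *-assoc; pos-*)
  open import Data.Integer.Tactic.RingSolver using (solve-∀)
  open import Data.List using (List; []; _∷_; length; cartesianProduct; cartesianProductWith)
  open import Data.List.Membership.Propositional using (_∈_)
  open import Data.List.Membership.Propositional.Properties using (∈-cartesianProductWith⁺; ∈-cartesianProduct⁺)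
  open import Data.List.Relation.Unary.Any using (here)
  open import Data.List.Relation.Unary.AllPairs using ([]; _∷_)
  open import Data.List.Relation.Unary.All using ([])
  open import Data.List.Relation.Unary.Unique.Propositional using (Unique)
  open import Data.List.Relation.Unary.Unique.Propositional.Properties using (cartesianProductWith⁺; cartesianProduct⁺)
  open import Data.Nat as ℕ using (ℕ; zero; suc; _^_)
  open import Data.Product using (_×_; _,_; proj₁; proj₂)
  open import Data.Vec using (Vec; []; _∷_)
  open import Data.Vec.Properties using (∷-injective) renaming (≡-dec to ≡-decᵛ)
  open import Relation.Binary.Definitions using (DecidableEquality)
  open import Relation.Binary.PropositionalEquality
  open import Relation.Nullary using (yes; no)

  q : ℕ
  q = size

  _≟ᵛ_ : ∀ {s} → DecidableEquality (Vec Carrier s)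
  _≟ᵛ_ = ≡-decᵛ _≟_

  allVectors : (s : ℕ) → List (Vec Carrier s)
  allVectors zero = [] ∷ []
  allVectors (suc s) = cartesianProductWith _∷_ elements (allVectors s)

  allVectors-unique : ∀ s → Unique (allVectors s)
  allVectors-unique zero = [] ∷ []
  allVectors-unique (suc s) = cartesianProductWith⁺ _∷_ ∷-injective elements-unique (allVectors-unique s)

  ∈-allVectors : ∀ {s} (v : Vec Carrier s) → v ∈ allVectors s
  ∈-allVectors [] = here refl
  ∈-allVectors (a ∷ v) = ∈-cartesianProductWith⁺ _∷_ (elements-complete a) (∈-allVectors v)

  ∑-allVectors-suc : ∀ s (f : Vec Carrier (suc s) → ℤ) →
                     ∑ (allVectors (suc s)) f ≡ ∑[ a ∈ elements ] ∑[ v ∈ allVectors s ] f (a ∷ v)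
  ∑-allVectors-suc s = ∑-cartesianProductWith _∷_ elements (allVectors s)

  ∑-allVectors-const : ∀ s k → ∑[ _ ∈ allVectors s ] k ≡ + q ^ s * k
  ∑-allVectors-const zero k = trans (+-identityʳ k) (sym (*-identityˡ k))
  ∑-allVectors-const (suc s) k = begin
    ∑[ _ ∈ allVectors (suc s) ] k                        ≡⟨ ∑-allVectors-suc s (λ _ → k) ⟩
    ∑[ a ∈ elements ] ∑[ _ ∈ allVectors s ] k            ≡⟨ ∑-cong elements (λ _ → ∑-allVectors-const s k) ⟩
    ∑[ a ∈ elements ] (+ q ^ s * k)                      ≡⟨ ∑-const elements _ ⟩
    + q * (+ q ^ s * k)                                  ≡⟨ *-assoc (+ q) _ k ⟨
    + q * + q ^ s * k                                    ≡⟨ cong (_* k) (pos-* q (q ^ s)) ⟨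
    + q ^ suc s * k                                      ∎
    where open ≡-Reasoning

  ∑-linear-root : ∀ {e} → e ≢ 0# → ∀ k → ∑[ a ∈ elements ] ⟦ (a *ᴷ e +ᴷ k) ≟ 0# ⟧ ≡ 1ℤ
  ∑-linear-root e≢0 k with linear-root e≢0 k
  ... | a₀ , root , unique = ∑-⟦⟧-unique _≟_ elements-unique (elements-complete a₀) (λ a → (a *ᴷ _ +ᴷ k) ≟ 0#) root unique

  ∑-hyperplane : ∀ s (d : Vec Carrier (suc s)) k → d ≢ 0ᵛ →
                 ∑[ w ∈ allVectors (suc s) ] ⟦ (w · d +ᴷ k) ≟ 0# ⟧ ≡ + q ^ s
  ∑-hyperplane s (e ∷ d′) k d≢0 with d′ ≟ᵛ 0ᵛ
  ... | yes refl = begin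
    ∑[ w ∈ allVectors (suc s) ] ⟦ (w · d +ᴷ k) ≟ 0# ⟧                              ≡⟨ ∑-allVectors-suc s _ ⟩
    ∑[ a ∈ elements ] ∑[ w ∈ allVectors s ] ⟦ ((a *ᴷ e +ᴷ w · 0ᵛ) +ᴷ k) ≟ 0# ⟧
      ≡⟨ ∑-cong elements (λ a → ∑-cong (allVectors s) (λ w → cong (λ z → ⟦ ((a *ᴷ e +ᴷ z) +ᴷ k) ≟ 0# ⟧) (·-zeroʳ w))) ⟩
    ∑[ a ∈ elements ] ∑[ w ∈ allVectors s ] ⟦ ((a *ᴷ e +ᴷ 0#) +ᴷ k) ≟ 0# ⟧         ≡⟨ ∑-cong elements (λ a → ∑-allVectors-const s _) ⟩
    ∑[ a ∈ elements ] (+ q ^ s * ⟦ ((a *ᴷ e +ᴷ 0#) +ᴷ k) ≟ 0# ⟧)                   ≡⟨ ∑-*ˡ elements (+ q ^ s) _ ⟩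
    + q ^ s * ∑[ a ∈ elements ] ⟦ ((a *ᴷ e +ᴷ 0#) +ᴷ k) ≟ 0# ⟧
      ≡⟨ cong (+ q ^ s *_) (∑-cong elements (λ a → cong (λ z → ⟦ (z +ᴷ k) ≟ 0# ⟧) (+ᴷ-identityʳ (a *ᴷ e)))) ⟩
    + q ^ s * ∑[ a ∈ elements ] ⟦ (a *ᴷ e +ᴷ k) ≟ 0# ⟧                             ≡⟨ cong (+ q ^ s *_) (∑-linear-root e≢0 k) ⟩
    + q ^ s * 1ℤ                                                                  ≡⟨ *-identityʳ _ ⟩
    + q ^ s                                                                       ∎
    where
    open ≡-Reasoning
    d : Vec Carrier (suc s)
    d = e ∷ 0ᵛ
    e≢0 : e ≢ 0#
    e≢0 e≡0 = d≢0 (cong (_∷ 0ᵛ) e≡0)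
  ∑-hyperplane zero (e ∷ []) k d≢0 | no []≢[] = ⊥-elim ([]≢[] refl)
  ∑-hyperplane (suc s) (e ∷ d′) k d≢0 | no d′≢0 = begin
    ∑[ w ∈ allVectors (suc (suc s)) ] ⟦ (w · (e ∷ d′) +ᴷ k) ≟ 0# ⟧              ≡⟨ ∑-allVectors-suc (suc s) _ ⟩
    ∑[ a ∈ elements ] ∑[ w ∈ allVectors (suc s) ] ⟦ ((a *ᴷ e +ᴷ w · d′) +ᴷ k) ≟ 0# ⟧
      ≡⟨ ∑-cong elements (λ a → ∑-cong (allVectors (suc s)) (λ w → cong (λ z → ⟦ z ≟ 0# ⟧) (xy∙z≈y∙xz (a *ᴷ e) (w · d′) k))) ⟩
    ∑[ a ∈ elements ] ∑[ w ∈ allVectors (suc s) ] ⟦ (w · d′ +ᴷ (a *ᴷ e +ᴷ k)) ≟ 0# ⟧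
      ≡⟨ ∑-cong elements (λ a → ∑-hyperplane s d′ (a *ᴷ e +ᴷ k) d′≢0) ⟩
    ∑[ a ∈ elements ] (+ q ^ s)                                                 ≡⟨ ∑-const elements _ ⟩
    + q * + q ^ s                                                               ≡⟨ pos-* q (q ^ s) ⟨
    + q ^ suc s                                                                 ∎
    where open ≡-Reasoning

  onQuadric : ∀ {s} → Vec Carrier s × Carrier → Vec Carrier s → ℤ
  onQuadric (w , c) y = ⟦ (c +ᴷ (w · y +ᴷ norm² K y)) ≟ 0# ⟧

  quadrics : (s : ℕ) → List (Vec Carrier s × Carrier)
  quadrics s = cartesianProduct (allVectors s) elements

  quadrics-unique : ∀ s → Unique (quadrics s)
  quadrics-unique s = cartesianProduct⁺ (allVectors-unique s) elements-unique

  ∈-quadrics : ∀ {s} w c → (w , c) ∈ quadrics s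
  ∈-quadrics w c = ∈-cartesianProduct⁺ (∈-allVectors w) (elements-complete c)

  ∑-quadrics : ∀ s (f : Vec Carrier s × Carrier → ℤ) →
               ∑ (quadrics s) f ≡ ∑[ w ∈ allVectors s ] ∑[ c ∈ elements ] f (w , c)
  ∑-quadrics s = ∑-cartesianProductWith _,_ (allVectors s) elements

  length-quadrics : ∀ s → + length (quadrics s) ≡ + q ^ s * + q
  length-quadrics s = begin
    + length (quadrics s)                               ≡⟨ *-identityʳ _ ⟨
    + length (quadrics s) * 1ℤ                          ≡⟨ ∑-const (quadrics s) 1ℤ ⟨
    ∑[ _ ∈ quadrics s ] 1ℤ                              ≡⟨ ∑-quadrics s _ ⟩
    ∑[ w ∈ allVectors s ] ∑[ _ ∈ elements ] 1ℤ          ≡⟨ ∑-cong (allVectors s) (λ _ → ∑-const elements 1ℤ) ⟩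
    ∑[ w ∈ allVectors s ] (+ q * 1ℤ)                    ≡⟨ ∑-allVectors-const s _ ⟩
    + q ^ s * (+ q * 1ℤ)                                ≡⟨ cong (+ q ^ s *_) (*-identityʳ (+ q)) ⟩
    + q ^ s * + q                                       ∎
    where open ≡-Reasoning

  ∑-translate-root : ∀ u → ∑[ c ∈ elements ] ⟦ (c +ᴷ u) ≟ 0# ⟧ ≡ 1ℤ
  ∑-translate-root u = ∑-⟦⟧-unique _≟_ elements-unique (elements-complete (-ᴷ u)) (λ c → (c +ᴷ u) ≟ 0#)
                         (proj₂ (+≡0⇔≡- (-ᴷ u) u) refl) (λ c → proj₁ (+≡0⇔≡- c u))

  ∑-translate-root-pair : ∀ u u′ → ∑[ c ∈ elements ] (⟦ (c +ᴷ u) ≟ 0# ⟧ * ⟦ (c +ᴷ u′) ≟ 0# ⟧) ≡ ⟦ (-ᴷ u +ᴷ u′) ≟ 0# ⟧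
  ∑-translate-root-pair u u′ = begin
    ∑[ c ∈ elements ] (⟦ (c +ᴷ u) ≟ 0# ⟧ * ⟦ (c +ᴷ u′) ≟ 0# ⟧)     ≡⟨ ∑-cong elements (λ c → cong (_* ⟦ (c +ᴷ u′) ≟ 0# ⟧) (root c)) ⟩
    ∑[ c ∈ elements ] (⟦ c ≟ (-ᴷ u) ⟧ * ⟦ (c +ᴷ u′) ≟ 0# ⟧)          ≡⟨ ∑-select _≟_ elements-unique (elements-complete (-ᴷ u)) _ ⟩
    ⟦ (-ᴷ u +ᴷ u′) ≟ 0# ⟧                                          ∎
    where
    open ≡-Reasoning
    root : ∀ c → ⟦ (c +ᴷ u) ≟ 0# ⟧ ≡ ⟦ c ≟ (-ᴷ u) ⟧
    root c = ⟦⟧-cong ((c +ᴷ u) ≟ 0#) (c ≟ (-ᴷ u)) (proj₁ (+≡0⇔≡- c u)) (proj₂ (+≡0⇔≡- c u))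

  ∑-onQuadric : ∀ s y → ∑[ ω ∈ quadrics s ] onQuadric ω y ≡ + q ^ s
  ∑-onQuadric s y = begin
    ∑[ ω ∈ quadrics s ] onQuadric ω y                                  ≡⟨ ∑-quadrics s _ ⟩
    ∑[ w ∈ allVectors s ] ∑[ c ∈ elements ] onQuadric (w , c) y        ≡⟨ ∑-cong (allVectors s) (λ w → ∑-translate-root _) ⟩
    ∑[ w ∈ allVectors s ] 1ℤ                                           ≡⟨ ∑-allVectors-const s 1ℤ ⟩
    + q ^ s * 1ℤ                                                       ≡⟨ *-identityʳ _ ⟩
    + q ^ s                                                            ∎
    where open ≡-Reasoning

  ∑-onQuadric-pair : ∀ s y y′ → y ≢ y′ → ∑[ ω ∈ quadrics (suc s) ] (onQuadric ω y * onQuadric ω y′) ≡ + q ^ s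
  ∑-onQuadric-pair s y y′ y≢y′ = begin
    ∑[ ω ∈ quadrics (suc s) ] (onQuadric ω y * onQuadric ω y′)                             ≡⟨ ∑-quadrics (suc s) _ ⟩
    ∑[ w ∈ allVectors (suc s) ] ∑[ c ∈ elements ] (onQuadric (w , c) y * onQuadric (w , c) y′)
      ≡⟨ ∑-cong (allVectors (suc s)) (λ w → ∑-translate-root-pair _ _) ⟩
    ∑[ w ∈ allVectors (suc s) ] ⟦ (-ᴷ (w · y +ᴷ norm² K y) +ᴷ (w · y′ +ᴷ norm² K y′)) ≟ 0# ⟧
      ≡⟨ ∑-cong (allVectors (suc s)) (λ w → cong (λ z → ⟦ z ≟ 0# ⟧) (quadric-difference w y y′)) ⟩
    ∑[ w ∈ allVectors (suc s) ] ⟦ (w · vsub K y′ y +ᴷ (-ᴷ norm² K y +ᴷ norm² K y′)) ≟ 0# ⟧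
      ≡⟨ ∑-hyperplane s (vsub K y′ y) _ (λ y′-y≡0 → y≢y′ (sym (vsub≡0ᵛ⇒≡ y′ y y′-y≡0))) ⟩
    + q ^ s                                                                                  ∎
    where open ≡-Reasoning

  ∑-onQuadric-pair-value : ∀ s y y′ → ∑[ ω ∈ quadrics (suc s) ] (onQuadric ω y * onQuadric ω y′)
                                        ≡ ⟦ y ≟ᵛ y′ ⟧ * (+ q ^ suc s - + q ^ s) + + q ^ s
  ∑-onQuadric-pair-value s y y′ with y ≟ᵛ y′
  ... | yes refl = begin
    ∑[ ω ∈ quadrics (suc s) ] (onQuadric ω y * onQuadric ω y)    ≡⟨ ∑-cong (quadrics (suc s)) (λ ω → ⟦⟧-idem (_ ≟ 0#)) ⟩
    ∑[ ω ∈ quadrics (suc s) ] onQuadric ω y                      ≡⟨ ∑-onQuadric (suc s) y ⟩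
    + q ^ suc s                                                  ≡⟨ cancel (+ q ^ suc s) (+ q ^ s) ⟩
    1ℤ * (+ q ^ suc s - + q ^ s) + + q ^ s                       ∎
    where
    open ≡-Reasoning
    cancel : ∀ a b → a ≡ 1ℤ * (a - b) + b
    cancel = solve-∀
  ... | no y≢y′ = begin
    ∑[ ω ∈ quadrics (suc s) ] (onQuadric ω y * onQuadric ω y′)   ≡⟨ ∑-onQuadric-pair s y y′ y≢y′ ⟩
    + q ^ s                                                      ≡⟨ +-identityˡ (+ q ^ s) ⟨
    0ℤ + + q ^ s                                                 ≡⟨ cong (_+ + q ^ s) (*-zeroˡ (+ q ^ suc s - + q ^ s)) ⟨
    0ℤ * (+ q ^ suc s - + q ^ s) + + q ^ s                       ∎
    where open ≡-Reasoning

module ZeroSphereIncidences (K : FiniteField) (s′ : ℕ) where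

  open FieldAlgebra K renaming (_+_ to _+ᴷ_; _*_ to _*ᴷ_; -_ to -ᴷ_)
  open Counting K
  open IntegerSums
  open import Data.Integer using (ℤ; +_; 1ℤ; _+_; _-_; _*_; -_; _≤_)
  open import Data.Integer.Properties
    using (*-identityˡ; pos-*; neg-distribʳ-*; *-monoˡ-≤-nonNeg; drop‿+≤+; m-n≡m⊖n; ⊖-≥; module ≤-Reasoning)
  open import Data.Integer.Tactic.RingSolver using (solve-∀)
  open import Data.Nat.Tactic.RingSolver renaming (solve-∀ to ℕ-solve-∀) using ()
  open import Data.List using (List; length; cartesianProduct)
  open import Data.List.Membership.Propositional using (_∈_)
  open import Data.List.Relation.Unary.Unique.Propositional using (Unique)
  open import Data.Nat as ℕ using (ℕ; suc; _^_)
  open import Data.Product using (_×_; _,_; proj₁; proj₂)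
  open import Data.Product.Properties using () renaming (≡-dec to ≡-dec×)
  open import Data.Vec using (Vec)
  open import Function using (Injective; _∘_)
  open import Relation.Binary.PropositionalEquality

  s : ℕ
  s = suc s′

  zeroSphere : Vec Carrier s → Vec Carrier s × Carrier
  zeroSphere x = -2× x , norm² K x

  zeroSphere-injective : 1# +ᴷ 1# ≢ 0# → Injective _≡_ _≡_ zeroSphere
  zeroSphere-injective 1+1≢0 eq = -2×-injective 1+1≢0 (cong proj₁ eq)

  module _ (F : List (Vec Carrier s)) (uF : Unique F) where

    n : ℤ
    n = + length F

    incidences : Vec Carrier s × Carrier → ℤ
    incidences ω = ∑[ y ∈ F ] onQuadric ω y

    ∑-incidences : ∑ (quadrics s) incidences ≡ n * + q ^ s
    ∑-incidences = begin
      ∑[ ω ∈ quadrics s ] ∑[ y ∈ F ] onQuadric ω y      ≡⟨ ∑-comm (quadrics s) F _ ⟩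
      ∑[ y ∈ F ] ∑[ ω ∈ quadrics s ] onQuadric ω y      ≡⟨ ∑-cong F (∑-onQuadric s) ⟩
      ∑[ y ∈ F ] (+ q ^ s)                              ≡⟨ ∑-const F _ ⟩
      n * + q ^ s                                       ∎
      where open ≡-Reasoning

    ∑-incidences² : ∑[ ω ∈ quadrics s ] (incidences ω * incidences ω) ≡ n * ((+ q ^ s - + q ^ s′) + n * + q ^ s′)
    ∑-incidences² = begin
      ∑[ ω ∈ quadrics s ] (incidences ω * incidences ω)
        ≡⟨ ∑-cong (quadrics s) (λ ω → ∑-*-∑ F F (onQuadric ω) (onQuadric ω)) ⟩
      ∑[ ω ∈ quadrics s ] ∑[ y ∈ F ] ∑[ y′ ∈ F ] (onQuadric ω y * onQuadric ω y′)
        ≡⟨ trans (∑-comm (quadrics s) F _) (∑-cong F (λ y → ∑-comm (quadrics s) F _)) ⟩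
      ∑[ y ∈ F ] ∑[ y′ ∈ F ] ∑[ ω ∈ quadrics s ] (onQuadric ω y * onQuadric ω y′)
        ≡⟨ ∑-cong F (λ y → ∑-cong F (∑-onQuadric-pair-value s′ y)) ⟩
      ∑[ y ∈ F ] ∑[ y′ ∈ F ] (⟦ y ≟ᵛ y′ ⟧ * (+ q ^ s - + q ^ s′) + + q ^ s′)
        ≡⟨ ∑-cong-∈ F row ⟩
      ∑[ y ∈ F ] ((+ q ^ s - + q ^ s′) + n * + q ^ s′)
        ≡⟨ ∑-const F _ ⟩
      n * ((+ q ^ s - + q ^ s′) + n * + q ^ s′) ∎
      where
      open ≡-Reasoning
      row : ∀ {y} → y ∈ F → ∑[ y′ ∈ F ] (⟦ y ≟ᵛ y′ ⟧ * (+ q ^ s - + q ^ s′) + + q ^ s′) ≡ (+ q ^ s - + q ^ s′) + n * + q ^ s′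
      row {y} y∈F = begin
        ∑[ y′ ∈ F ] (⟦ y ≟ᵛ y′ ⟧ * (+ q ^ s - + q ^ s′) + + q ^ s′)
          ≡⟨ ∑-distrib-+ F _ _ ⟩
        ∑[ y′ ∈ F ] (⟦ y ≟ᵛ y′ ⟧ * (+ q ^ s - + q ^ s′)) + ∑[ y′ ∈ F ] (+ q ^ s′)
          ≡⟨ cong₂ _+_ (∑-*ʳ F _ (λ y′ → ⟦ y ≟ᵛ y′ ⟧)) (∑-const F _) ⟩
        ∑[ y′ ∈ F ] ⟦ y ≟ᵛ y′ ⟧ * (+ q ^ s - + q ^ s′) + n * + q ^ s′
          ≡⟨ cong (λ t → t * (+ q ^ s - + q ^ s′) + n * + q ^ s′)
                  (∑-⟦⟧-unique _≟ᵛ_ uF y∈F (λ y′ → y ≟ᵛ y′) refl (λ _ y≡y′ → sym y≡y′)) ⟩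
        1ℤ * (+ q ^ s - + q ^ s′) + n * + q ^ s′
          ≡⟨ cong (_+ n * + q ^ s′) (*-identityˡ (+ q ^ s - + q ^ s′)) ⟩
        (+ q ^ s - + q ^ s′) + n * + q ^ s′ ∎

    variance : ∑[ ω ∈ quadrics s ] ((+ q * incidences ω - n) * (+ q * incidences ω - n))
                 ≡ n * (+ q * + q) * + q ^ s′ * (+ q - 1ℤ)
    variance = begin
      ∑[ ω ∈ quadrics s ] ((+ q * incidences ω - n) * (+ q * incidences ω - n))
        ≡⟨ ∑-square-affine (quadrics s) (+ q) n incidences ⟩
      + q * + q * ∑[ ω ∈ quadrics s ] (incidences ω * incidences ω) - + 2 * + q * n * ∑ (quadrics s) incidences
        + + length (quadrics s) * (n * n)
        ≡⟨ cong₂ (λ a b → + q * + q * a - + 2 * + q * n * b + + length (quadrics s) * (n * n)) ∑-incidences² ∑-incidences ⟩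
      + q * + q * (n * ((+ q ^ s - + q ^ s′) + n * + q ^ s′)) - + 2 * + q * n * (n * + q ^ s)
        + + length (quadrics s) * (n * n)
        ≡⟨ cong (λ c → + q * + q * (n * ((+ q ^ s - + q ^ s′) + n * + q ^ s′)) - + 2 * + q * n * (n * + q ^ s) + c * (n * n))
                (length-quadrics s) ⟩
      + q * + q * (n * ((+ q ^ s - + q ^ s′) + n * + q ^ s′)) - + 2 * + q * n * (n * + q ^ s)
        + + q ^ s * + q * (n * n)
        ≡⟨ cong (λ a → + q * + q * (n * ((a - + q ^ s′) + n * + q ^ s′)) - + 2 * + q * n * (n * a) + a * + q * (n * n))
                (pos-* q (q ^ s′)) ⟩
      + q * + q * (n * ((+ q * + q ^ s′ - + q ^ s′) + n * + q ^ s′)) - + 2 * + q * n * (n * (+ q * + q ^ s′))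
        + + q * + q ^ s′ * + q * (n * n)
        ≡⟨ simplify (+ q) n (+ q ^ s′) ⟩
      n * (+ q * + q) * + q ^ s′ * (+ q - 1ℤ) ∎
      where
      open ≡-Reasoning
      simplify : ∀ q n y → q * q * (n * ((q * y - y) + n * y)) - + 2 * q * n * (n * (q * y)) + q * y * q * (n * n)
                             ≡ n * (q * q) * y * (q - 1ℤ)
      simplify = solve-∀

    ν≡∑-incidences : ∀ E → + ν K E F 0# ≡ ∑[ x ∈ E ] incidences (zeroSphere x)
    ν≡∑-incidences E = begin
      + ν K E F 0#
        ≡⟨ ∑-filter _ (cartesianProduct E F) ⟩
      ∑[ p ∈ cartesianProduct E F ] ⟦ norm² K (vsub K (proj₁ p) (proj₂ p)) ≟ 0# ⟧
        ≡⟨ ∑-cartesianProductWith _,_ E F _ ⟩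
      ∑[ x ∈ E ] ∑[ y ∈ F ] ⟦ norm² K (vsub K x y) ≟ 0# ⟧
        ≡⟨ ∑-cong E (λ x → ∑-cong F (λ y → cong (λ z → ⟦ z ≟ 0# ⟧) (norm²-vsub x y))) ⟩
      ∑[ x ∈ E ] incidences (zeroSphere x) ∎
      where open ≡-Reasoning

    ∑-deviation : ∀ E → ∑[ x ∈ E ] (+ q * incidences (zeroSphere x) - n) ≡ + q * + ν K E F 0# - + length E * n
    ∑-deviation E = begin
      ∑[ x ∈ E ] (+ q * incidences (zeroSphere x) - n)
        ≡⟨ ∑-distrib-+ E _ _ ⟩
      ∑[ x ∈ E ] (+ q * incidences (zeroSphere x)) + ∑[ _ ∈ E ] (- n)
        ≡⟨ cong₂ _+_ (trans (∑-*ˡ E (+ q) _) (cong (+ q *_) (sym (ν≡∑-incidences E))))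
                     (trans (∑-const E _) (sym (neg-distribʳ-* (+ length E) n))) ⟩
      + q * + ν K E F 0# - + length E * n ∎
      where open ≡-Reasoning

    zero-distance-bound : ∀ E → Unique E → 1# +ᴷ 1# ≢ 0# →
                          (+ q * + ν K E F 0# - + length E * n) * (+ q * + ν K E F 0# - + length E * n)
                            ≤ + length E * (n * (+ q * + q) * + q ^ s′ * (+ q - 1ℤ))
    zero-distance-bound E uE 1+1≢0 = begin
      (+ q * + ν K E F 0# - + length E * n) * (+ q * + ν K E F 0# - + length E * n)
        ≡⟨ cong (λ t → t * t) (∑-deviation E) ⟨
      ∑ E (deviation ∘ zeroSphere) * ∑ E (deviation ∘ zeroSphere)
        ≤⟨ cauchy-schwarz E (deviation ∘ zeroSphere) ⟩
      + length E * ∑[ x ∈ E ] (deviation (zeroSphere x) * deviation (zeroSphere x))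
        ≤⟨ *-monoˡ-≤-nonNeg (+ length E) (∑-∘-injective-≤ (≡-dec× _≟ᵛ_ _≟_) uE (quadrics-unique s) zeroSphere
                                            (zeroSphere-injective 1+1≢0) (λ x → ∈-quadrics _ _)
                                            (λ ω → deviation ω * deviation ω) (λ ω → 0≤i*i (deviation ω))) ⟩
      + length E * ∑[ ω ∈ quadrics s ] (deviation ω * deviation ω)
        ≡⟨ cong (+ length E *_) variance ⟩
      + length E * (n * (+ q * + q) * + q ^ s′ * (+ q - 1ℤ)) ∎
      where
      open ≤-Reasoning
      deviation : Vec Carrier s × Carrier → ℤ
      deviation ω = + q * incidences ω - n

    zero-distance-boundℕ : ∀ E → Unique E → 1# +ᴷ 1# ≢ 0# → 1 ℕ.≤ q →
                           (q ℕ.* ν K E F 0# ℕ.∸ length E ℕ.* length F) ℕ.* (q ℕ.* ν K E F 0# ℕ.∸ length E ℕ.* length F)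
                             ℕ.≤ length E ℕ.* length F ℕ.* (q ℕ.* q ℕ.* q ^ s′ ℕ.* (q ℕ.∸ 1))
    zero-distance-boundℕ E uE 1+1≢0 1≤q = drop‿+≤+ (begin
      + ((qν ℕ.∸ P) ℕ.* (qν ℕ.∸ P))                                      ≤⟨ +[m∸n]²≤[m-n]² qν P ⟩
      (+ qν - + P) * (+ qν - + P)                                          ≡⟨ cong (λ t → t * t) (cong₂ _-_ (pos-* q _) (pos-* (length E) (length F))) ⟩
      (+ q * + ν K E F 0# - + length E * n) * (+ q * + ν K E F 0# - + length E * n) ≤⟨ zero-distance-bound E uE 1+1≢0 ⟩
      + length E * (n * (+ q * + q) * + q ^ s′ * (+ q - 1ℤ))             ≡⟨ toℕ ⟩
      + (P ℕ.* (q ℕ.* q ℕ.* q ^ s′ ℕ.* (q ℕ.∸ 1)))                        ∎)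
      where
      open ≤-Reasoning
      qν P : ℕ
      qν = q ℕ.* ν K E F 0#
      P = length E ℕ.* length F
      toℕ : + length E * (n * (+ q * + q) * + q ^ s′ * (+ q - 1ℤ)) ≡ + (P ℕ.* (q ℕ.* q ℕ.* q ^ s′ ℕ.* (q ℕ.∸ 1)))
      toℕ = begin-equality
        + length E * (n * (+ q * + q) * + q ^ s′ * (+ q - 1ℤ))
          ≡⟨ cong (λ t → + length E * (n * (+ q * + q) * + q ^ s′ * t)) (trans (m-n≡m⊖n q 1) (⊖-≥ 1≤q)) ⟩
        + length E * (n * (+ q * + q) * + q ^ s′ * + (q ℕ.∸ 1))
          ≡⟨ cong (λ t → + length E * (n * t * + q ^ s′ * + (q ℕ.∸ 1))) (pos-* q q) ⟨
        + length E * (n * + (q ℕ.* q) * + q ^ s′ * + (q ℕ.∸ 1))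
          ≡⟨ cong (λ t → + length E * (t * + q ^ s′ * + (q ℕ.∸ 1))) (pos-* (length F) (q ℕ.* q)) ⟨
        + length E * (+ (length F ℕ.* (q ℕ.* q)) * + q ^ s′ * + (q ℕ.∸ 1))
          ≡⟨ cong (λ t → + length E * (t * + (q ℕ.∸ 1))) (pos-* (length F ℕ.* (q ℕ.* q)) (q ^ s′)) ⟨
        + length E * (+ (length F ℕ.* (q ℕ.* q) ℕ.* q ^ s′) * + (q ℕ.∸ 1))
          ≡⟨ cong (+ length E *_) (pos-* (length F ℕ.* (q ℕ.* q) ℕ.* q ^ s′) (q ℕ.∸ 1)) ⟨
        + length E * + (length F ℕ.* (q ℕ.* q) ℕ.* q ^ s′ ℕ.* (q ℕ.∸ 1))
          ≡⟨ pos-* (length E) _ ⟨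
        + (length E ℕ.* (length F ℕ.* (q ℕ.* q) ℕ.* q ^ s′ ℕ.* (q ℕ.∸ 1)))
          ≡⟨ cong +_ (reassociate (length E) (length F) q (q ^ s′) (q ℕ.∸ 1)) ⟩
        + (P ℕ.* (q ℕ.* q ℕ.* q ^ s′ ℕ.* (q ℕ.∸ 1)))  ∎
        where
        reassociate : ∀ e f q y r → e ℕ.* (f ℕ.* (q ℕ.* q) ℕ.* y ℕ.* r) ≡ e ℕ.* f ℕ.* (q ℕ.* q ℕ.* y ℕ.* r)
        reassociate = ℕ-solve-∀

open import Data.Nat using (suc; _+_; _*_; _∸_; _^_; _≤_; _%_; z≤n; s≤s; _≤?_; >-nonZero)
open import Data.Nat.Properties
open import Data.Nat.Tactic.RingSolver using (solve-∀)
open import Data.Vec using (Vec)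
open import Data.List using (List; []; _∷_; length)
open import Data.List.Membership.Propositional using (_∈_)
open import Data.List.Relation.Unary.Any using (here)
open import Data.List.Relation.Unary.Unique.Propositional using (Unique)
open import Relation.Binary.PropositionalEquality
open import Relation.Nullary using (yes; no; contradiction)

two-distinct⇒2≤length : ∀ {A : Set} {L : List A} {x y} → x ∈ L → y ∈ L → x ≢ y → 2 ≤ length L
two-distinct⇒2≤length {L = _ ∷ []} (here refl) (here refl) x≢y = contradiction refl x≢y
two-distinct⇒2≤length {L = _ ∷ _ ∷ _} _ _ _ = s≤s (s≤s z≤n)

m*m≤n*n⇒m≤n : ∀ m n → m * m ≤ n * n → m ≤ n
m*m≤n*n⇒m≤n m n m²≤n² with m ≤? n
... | yes m≤n = m≤n
... | no m≰n = contradiction m²≤n² (<⇒≱ (*-mono-< (≰⇒> m≰n) (≰⇒> m≰n)))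

-- The square bound gives q ν - P ≤ q P / 30, so ν ≤ P / q + P / 30 ≤ 16 P / 30.
zero-distance-arithmetic : ∀ {q ν P y} → 2 ≤ q → 900 * (q * y) ≤ P →
                           (q * ν ∸ P) * (q * ν ∸ P) ≤ P * (q * q * y * (q ∸ 1)) → 30 * ν ≤ 21 * P
zero-distance-arithmetic {q} {ν} {P} {y} 2≤q 900qy≤P D²≤ = ≤-trans 30ν≤16P (*-monoˡ-≤ P 16≤21)
  where
  open ≤-Reasoning
  16≤21 : 16 ≤ 21
  16≤21 = m≤m+n 16 5
  D : ℕ
  D = q * ν ∸ P
  30D≤Pq : 30 * D ≤ P * q
  30D≤Pq = m*m≤n*n⇒m≤n (30 * D) (P * q) (begin
    (30 * D) * (30 * D)                   ≡⟨ lemma₁ D ⟩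
    900 * (D * D)                         ≤⟨ *-monoʳ-≤ 900 D²≤ ⟩
    900 * (P * (q * q * y * (q ∸ 1)))     ≡⟨ lemma₂ P q y (q ∸ 1) ⟩
    P * q * (q ∸ 1) * (900 * (q * y))     ≤⟨ *-monoʳ-≤ (P * q * (q ∸ 1)) 900qy≤P ⟩
    P * q * (q ∸ 1) * P                   ≤⟨ *-monoˡ-≤ P (*-monoʳ-≤ (P * q) (m∸n≤m q 1)) ⟩
    P * q * q * P                         ≡⟨ lemma₃ P q ⟩
    (P * q) * (P * q)                     ∎)
    where
    lemma₁ : ∀ d → (30 * d) * (30 * d) ≡ 900 * (d * d)
    lemma₁ = solve-∀
    lemma₂ : ∀ p q y r → 900 * (p * (q * q * y * r)) ≡ p * q * r * (900 * (q * y))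
    lemma₂ = solve-∀
    lemma₃ : ∀ p q → p * q * q * p ≡ (p * q) * (p * q)
    lemma₃ = solve-∀
  q*30ν≤q*16P : q * (30 * ν) ≤ q * (16 * P)
  q*30ν≤q*16P = begin
    q * (30 * ν)          ≡⟨ *-comm q (30 * ν) ⟩
    30 * ν * q            ≡⟨ *-assoc 30 ν q ⟩
    30 * (ν * q)          ≡⟨ cong (30 *_) (*-comm ν q) ⟩
    30 * (q * ν)          ≤⟨ *-monoʳ-≤ 30 (m≤n+m∸n (q * ν) P) ⟩
    30 * (P + D)          ≡⟨ *-distribˡ-+ 30 P D ⟩
    30 * P + 30 * D       ≤⟨ +-mono-≤ (*-monoˡ-≤ P (*-monoʳ-≤ 15 2≤q)) 30D≤Pq ⟩
    15 * q * P + P * q    ≡⟨ lemma q P ⟩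
    q * (16 * P)          ∎
    where
    lemma : ∀ q p → 15 * q * p + p * q ≡ q * (16 * p)
    lemma = solve-∀
  30ν≤16P : 30 * ν ≤ 16 * P
  30ν≤16P = *-cancelˡ-≤ q {{>-nonZero (≤-trans (s≤s z≤n) 2≤q)}} q*30ν≤q*16P

lemma5p2 : (K : FiniteField) → FiniteField.size K % 2 ≡ 1 →
           (s : ℕ) → 2 ≤ s →
           (E F : List (Vec (FiniteField.Carrier K) s)) → Unique E → Unique F →
           900 * FiniteField.size K ^ s ≤ length E * length F →
           30 * ν K E F (FiniteField.0# K) ≤ 21 * (length E * length F)
lemma5p2 K odd (suc s′) _ E F uE uF 900q^s≤P =
  zero-distance-arithmetic 2≤q 900q^s≤P (zero-distance-boundℕ F uF E uE (1+1≢0 odd) (≤-trans (s≤s z≤n) 2≤q))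
  where
  open FiniteField K using (0≢1)
  open FieldAlgebra K using (size; elements-complete; 0#; 1#; 1+1≢0)
  open ZeroSphereIncidences K s′ using (zero-distance-boundℕ)
  2≤q : 2 ≤ size
  2≤q = two-distinct⇒2≤length (elements-complete 0#) (elements-complete 1#) 0≢1
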